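{- Let $n,n_1,n_2$ be positive integers with $n=n_1+n_2+1$. Then $\mathrm{unv}(D_1(0,n-1))=\mathrm{unv}(D_1(n-1,0))=2n-2$, and $\mathrm{unv}(D_1(n_1,n_2))=2n-3$.
   Context: For nonnegative integers $a,b$, $D_1(a,b)$ is the oriented star consisting of a vertex $s$ together with $a$ vertices each dominating $s$ and $b$ vertices each dominated by $s$, with no other arcs. A digraph is $p$-unavoidable if it is contained in (isomorphic to a subdigraph of) every tournament of order $p$; $\mathrm{unv}(D)$ is the least such $p$. -}

module Defs where

open import Data.Nat using (ℕ; zero; suc; _+_; _<_; _<ᵇ_)
open import Data.Bool using (Bool; true; false; not)
open import Data.Fin using (Fin; zero; suc; toℕ)
open import Data.Product using (Σ; _×_; ∃)
open import Data.Sum using (_⊎_)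
open import Relation.Binary.PropositionalEquality using (_≡_; _≢_)
open import Relation.Nullary using (¬_)
open import Function.Definitions using (Injective)

record Digraph : Set where
  field
    order : ℕ
    arc   : Fin order → Fin order → Bool
open Digraph public

record Tournament (p : ℕ) : Set where
  field
    adj     : Fin p → Fin p → Bool
    loopless : ∀ i → adj i i ≡ false
    total   : ∀ i j → i ≢ j → (adj i j ≡ true) ⊎ (adj j i ≡ true)
    antisym : ∀ i j → adj i j ≡ true → adj j i ≡ false
open Tournament public

_⊑_ : Digraph → {p : ℕ} → Tournament p → Set
(D ⊑ T) = Σ (Fin (order D) → Fin _) λ f →
  Injective _≡_ _≡_ f × (∀ u v → arc D u v ≡ true → adj T (f u) (f v) ≡ true)

Unavoidable : Digraph → ℕ → Set
Unavoidable D p = (T : Tournament p) → D ⊑ T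

UnvIs : Digraph → ℕ → Set
UnvIs D q = Unavoidable D q × (∀ p → p < q → ¬ Unavoidable D p)

-- The oriented star D₁(a,b): vertex 0 is the centre s; vertices suc i with
-- toℕ i < a dominate s; vertices suc i with toℕ i ≥ a are dominated by s.
D₁ : ℕ → ℕ → Digraph
D₁ a b = record { order = suc (a + b) ; arc = star }
  where
  star : Fin (suc (a + b)) → Fin (suc (a + b)) → Bool
  star (suc i) zero = toℕ i <ᵇ a
  star zero (suc i) = not (toℕ i <ᵇ a)
  star _ _ = false

{-# OPTIONS --safe #-}
-- A copy of D₁(a,b) is a vertex with a in-neighbours and b out-neighbours, so D₁(a,b) is avoided
-- exactly by the tournaments in which every vertex has in-degree < a or out-degree < b.
-- Counting the arcs inside a vertex set S in two ways gives |S|(|S|-1)/2 ≤ |S|(b-1) when every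
-- vertex of S has fewer than b out-neighbours, so |S| ≤ 2b ∸ 1; splitting the vertices of an
-- avoiding tournament according to which degree is small bounds its order by (2a ∸ 1) + (2b ∸ 1).
-- Conversely, the reverse of a regular tournament on 2a-1 vertices, dominating a regular
-- tournament on 2b-1 vertices, avoids D₁(a,b). Hence unv(D₁(a,b)) = 1 + (2a ∸ 1) + (2b ∸ 1) for
-- all a and b, and the three cases of the proposition are instances of this formula.

module Submission where

open import Defs
open import Data.Nat using (ℕ; _+_; _*_; _∸_; _≤_)
open import Data.Product using (_×_)
open import Relation.Binary.PropositionalEquality using (_≡_)

open import Data.Bool using (Bool; true; false; not; _∧_)
open import Data.Bool.Properties using (T-≡; ∧-identityʳ; not-injective; not-involutive; not-¬)
open import Data.Empty using (⊥-elim)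
open import Data.Fin using (Fin; zero; suc; toℕ; splitAt; join; _↑ˡ_; _↑ʳ_; inject≤)
open import Data.Fin.Properties
  using (_≟_; any?; suc-injective; 0≢1+n; toℕ<n; toℕ-↑ˡ; toℕ-↑ʳ; ↑ˡ-injective; ↑ʳ-injective;
         splitAt-join; join-splitAt; splitAt⁻¹-↑ˡ; splitAt⁻¹-↑ʳ; inject≤-injective)
open import Data.Nat using (zero; suc; _<_; _<ᵇ_; s≤s; z≤n)
open import Data.Nat.Properties hiding (_≟_; 0≢1+n; suc-injective)
open import Algebra.Properties.CommutativeMonoid.Sum +-0-commutativeMonoid
  using (sum; sum-cong-≗; ∑-distrib-+; sum-replicate-zero)
open import Data.Nat.Tactic.RingSolver using (solve-∀)
open import Data.Product using (Σ; ∃; _,_)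
open import Data.Sum using (_⊎_; inj₁; inj₂; [_,_]′)
open import Data.Vec.Functional using (_∷_)
open import Function using (_∘_; id; flip; Equivalence)
open import Function.Definitions using (Injective)
open import Relation.Binary.PropositionalEquality
  using (refl; sym; trans; cong; cong₂; subst; _≢_; module ≡-Reasoning)
open import Relation.Nullary using (¬_; does; yes; no; contradiction; _×-dec_)
open import Relation.Nullary.Decidable using (dec-false)

private variable
  a b k m n p q : ℕ

bit : Bool → ℕ
bit true = 1
bit false = 0

count : (Fin p → Bool) → ℕ
count P = sum (bit ∘ P)

count-cong : {P Q : Fin p → Bool} → (∀ i → P i ≡ Q i) → count P ≡ count Q
count-cong {P = P} {Q} P≗Q = sum-cong-≗ {x = bit ∘ P} {y = bit ∘ Q} (cong bit ∘ P≗Q)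

sum-mono-≤ : {f g : Fin p → ℕ} → (∀ i → f i ≤ g i) → sum f ≤ sum g
sum-mono-≤ {zero} _ = z≤n
sum-mono-≤ {suc p} f≤g = +-mono-≤ (f≤g zero) (sum-mono-≤ (f≤g ∘ suc))

sum-const : ∀ p c → sum {p} (λ _ → c) ≡ p * c
sum-const zero c = refl
sum-const (suc p) c = cong (c +_) (sum-const p c)

sum-↑ : ∀ m (f : Fin (m + n) → ℕ) → sum f ≡ sum (f ∘ (_↑ˡ n)) + sum (f ∘ (m ↑ʳ_))
sum-↑ zero f = refl
sum-↑ (suc m) f = trans (cong (f zero +_) (sum-↑ m (f ∘ suc))) (sym (+-assoc (f zero) _ _))

count-partition : (P : Fin p → Bool) → count P + count (not ∘ P) ≡ p
count-partition {zero} P = refl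
count-partition {suc p} P with P zero
... | true = cong suc (count-partition (P ∘ suc))
... | false = trans (+-suc _ _) (cong suc (count-partition (P ∘ suc)))

count-remove : (P : Fin p → Bool) {x : Fin p} → P x ≡ true →
               count P ≡ suc (count (λ j → P j ∧ not (does (j ≟ x))))
count-remove P {zero} Px rewrite Px =
  cong suc (count-cong (λ j → sym (∧-identityʳ (P (suc j)))))
count-remove P {suc x} Px = begin
  bit (P zero) + count (P ∘ suc)     ≡⟨ cong (bit (P zero) +_) (count-remove (P ∘ suc) Px) ⟩
  bit (P zero) + suc rest            ≡⟨ +-suc (bit (P zero)) rest ⟩
  suc (bit (P zero) + rest)          ≡⟨ cong (λ c → suc (bit c + rest)) (sym (∧-identityʳ (P zero))) ⟩
  suc (bit (P zero ∧ true) + rest)   ∎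
  where
  open ≡-Reasoning
  rest : ℕ
  rest = count (λ j → P (suc j) ∧ not (does (j ≟ x)))

injective⇒≤-count : (P : Fin p → Bool) (g : Fin k → Fin p) → Injective _≡_ _≡_ g →
                    (∀ i → P (g i) ≡ true) → k ≤ count P
injective⇒≤-count {k = zero} P g _ _ = z≤n
injective⇒≤-count {k = suc k} P g g-inj Pg =
  subst (suc k ≤_) (sym (count-remove P (Pg zero)))
        (s≤s (injective⇒≤-count _ (g ∘ suc) (suc-injective ∘ g-inj) P′g))
  where
  P′g : ∀ i → (P (g (suc i)) ∧ not (does (g (suc i) ≟ g zero))) ≡ true
  P′g i rewrite Pg (suc i) | dec-false (g (suc i) ≟ g zero) (0≢1+n ∘ sym ∘ g-inj) = refl

∷-injective : {g : Fin n → Fin p} {x : Fin p} → Injective _≡_ _≡_ g → (∀ i → g i ≢ x) →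
              Injective _≡_ _≡_ (x ∷ g)
∷-injective g-inj g≢x {zero} {zero} _ = refl
∷-injective g-inj g≢x {zero} {suc j} e = ⊥-elim (g≢x j (sym e))
∷-injective g-inj g≢x {suc i} {zero} e = ⊥-elim (g≢x i e)
∷-injective g-inj g≢x {suc i} {suc j} e = cong suc (g-inj e)

≤-count⇒injective : ∀ k (P : Fin p → Bool) → k ≤ count P →
                    Σ (Fin k → Fin p) λ g → Injective _≡_ _≡_ g × (∀ i → P (g i) ≡ true)
≤-count⇒injective zero P _ = (λ ()) , (λ { {()} }) , (λ ())
≤-count⇒injective {zero} (suc k) P ()
≤-count⇒injective {suc p} (suc k) P k<count with P zero in P0
... | false with ≤-count⇒injective (suc k) (P ∘ suc) k<count
...   | g , g-inj , Pg = suc ∘ g , g-inj ∘ suc-injective , Pg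
≤-count⇒injective {suc p} (suc k) P (s≤s k≤count) | true
  with ≤-count⇒injective k (P ∘ suc) k≤count
... | g , g-inj , Pg = zero ∷ (suc ∘ g) , ∷-injective (g-inj ∘ suc-injective) (λ i ()) , P∷g
  where
  P∷g : ∀ i → P ((zero ∷ (suc ∘ g)) i) ≡ true
  P∷g zero = P0
  P∷g (suc i) = Pg i

count-∘-injective : (P : Fin p → Bool) {g : Fin m → Fin p} → Injective _≡_ _≡_ g →
                    count (P ∘ g) ≤ count P
count-∘-injective P {g} g-inj with ≤-count⇒injective _ (P ∘ g) ≤-refl
... | h , h-inj , Pgh = injective⇒≤-count P (g ∘ h) (h-inj ∘ g-inj) Pgh

tournament : (R : Fin p → Fin p → Bool) → (∀ i → R i i ≡ false) →
             (∀ {i j} → i ≢ j → R i j ≡ not (R j i)) → Tournament p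
tournament R R-loopless R-flip = record
  { adj = R ; loopless = R-loopless ; total = R-total ; antisym = R-antisym }
  where
  R-total : ∀ i j → i ≢ j → R i j ≡ true ⊎ R j i ≡ true
  R-total i j i≢j with R j i in Rji
  ... | true = inj₂ refl
  ... | false = inj₁ (trans (R-flip i≢j) (cong not Rji))
  R-antisym : ∀ i j → R i j ≡ true → R j i ≡ false
  R-antisym i j Rij with i ≟ j
  ... | yes refl = ⊥-elim (not-¬ Rij (R-loopless i))
  ... | no i≢j = trans (R-flip (i≢j ∘ sym)) (cong not Rij)

adj-flip : (T : Tournament p) {i j : Fin p} → i ≢ j → adj T i j ≡ not (adj T j i)
adj-flip T {i} {j} i≢j with total T i j i≢j
... | inj₁ Tij = trans Tij (sym (cong not (antisym T i j Tij)))
... | inj₂ Tji = trans (antisym T j i Tji) (cong not (sym Tji))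

induced : (g : Fin m → Fin p) → Injective _≡_ _≡_ g → Tournament p → Tournament m
induced g g-inj T =
  tournament (λ i j → adj T (g i) (g j)) (loopless T ∘ g) (λ i≢j → adj-flip T (i≢j ∘ g-inj))

reverse : Tournament p → Tournament p
reverse T = tournament (flip (adj T)) (loopless T) (λ i≢j → adj-flip T (i≢j ∘ sym))

tail : Tournament (suc p) → Tournament p
tail = induced suc suc-injective

outdeg indeg : Tournament p → Fin p → ℕ
outdeg T v = count (adj T v)
indeg T v = count (λ u → adj T u v)

-- Vertex 0 shares exactly one arc with each of the other p vertices; that arc counts towards
-- the out-degree of exactly one of its two ends.
sum-outdeg-tail : (T : Tournament (suc p)) → sum (outdeg T) ≡ p + sum (outdeg (tail T))
sum-outdeg-tail {p} T = begin
  bit (adj T zero zero) + count out₀ + sum (outdeg T ∘ suc)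
    ≡⟨ cong (λ c → bit c + count out₀ + sum (outdeg T ∘ suc)) (loopless T zero) ⟩
  count out₀ + sum (λ i → bit (adj T (suc i) zero) + outdeg (tail T) i)
    ≡⟨ cong (count out₀ +_) (∑-distrib-+ _ (outdeg (tail T))) ⟩
  count out₀ + (count (λ i → adj T (suc i) zero) + rest)
    ≡⟨ cong (λ c → count out₀ + (c + rest)) (count-cong λ i → adj-flip T (0≢1+n {i = i} ∘ sym)) ⟩
  count out₀ + (count (not ∘ out₀) + rest)
    ≡⟨ sym (+-assoc (count out₀) _ rest) ⟩
  count out₀ + count (not ∘ out₀) + rest
    ≡⟨ cong (_+ rest) (count-partition out₀) ⟩
  p + rest ∎
  where
  open ≡-Reasoning
  out₀ : Fin p → Bool
  out₀ i = adj T zero (suc i)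
  rest : ℕ
  rest = sum (outdeg (tail T))

handshake : (T : Tournament p) → 2 * sum (outdeg T) + p ≡ p * p
handshake {zero} T = refl
handshake {suc p} T = begin
  2 * sum (outdeg T) + suc p    ≡⟨ cong (λ e → 2 * e + suc p) (sum-outdeg-tail T) ⟩
  2 * (p + E) + suc p           ≡⟨ regroup p E ⟩
  (2 * E + p) + (2 * p + 1)     ≡⟨ cong (_+ (2 * p + 1)) (handshake (tail T)) ⟩
  p * p + (2 * p + 1)           ≡⟨ square-suc p ⟩
  suc p * suc p                 ∎
  where
  open ≡-Reasoning
  E : ℕ
  E = sum (outdeg (tail T))
  regroup : ∀ p E → 2 * (p + E) + suc p ≡ (2 * E + p) + (2 * p + 1)
  regroup = solve-∀
  square-suc : ∀ p → p * p + (2 * p + 1) ≡ suc p * suc p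
  square-suc = solve-∀

outdeg<⇒order≤ : (T : Tournament p) → (∀ v → outdeg T v < b) → p ≤ 2 * b ∸ 1
outdeg<⇒order≤ {zero} T _ = z≤n
outdeg<⇒order≤ {p@(suc _)} {b} T out<b = m+n≤o⇒m≤o∸n p (*-cancelˡ-≤ p p[p+1]≤p[2b])
  where
  open ≤-Reasoning
  E : ℕ
  E = sum (outdeg T)
  p+E≤pb : p + E ≤ p * b
  p+E≤pb = begin
    p + E                          ≡⟨ cong (_+ E) (sym (trans (sum-const p 1) (*-identityʳ p))) ⟩
    sum {p} (λ _ → 1) + E          ≡⟨ sym (∑-distrib-+ (λ _ → 1) (outdeg T)) ⟩
    sum (λ v → suc (outdeg T v))   ≤⟨ sum-mono-≤ out<b ⟩
    sum {p} (λ _ → b)              ≡⟨ sum-const p b ⟩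
    p * b                          ∎
  p[p+1]≤p[2b] : p * (p + 1) ≤ p * (2 * b)
  p[p+1]≤p[2b] = begin
    p * (p + 1)      ≡⟨ *-distribˡ-+ p p 1 ⟩
    p * p + p * 1    ≡⟨ cong₂ _+_ (sym (handshake T)) (*-identityʳ p) ⟩
    2 * E + p + p    ≡⟨ regroup p E ⟩
    2 * (p + E)      ≤⟨ *-monoʳ-≤ 2 p+E≤pb ⟩
    2 * (p * b)      ≡⟨ *-comm-middle 2 p b ⟩
    p * (2 * b)      ∎
    where
    regroup : ∀ p E → 2 * E + p + p ≡ 2 * (p + E)
    regroup = solve-∀
    *-comm-middle : ∀ x y z → x * (y * z) ≡ y * (x * z)
    *-comm-middle = solve-∀

outdeg<⇒count≤ : (T : Tournament p) (S : Fin p → Bool) →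
                 (∀ v → S v ≡ true → outdeg T v < b) → count S ≤ 2 * b ∸ 1
outdeg<⇒count≤ T S out<b with ≤-count⇒injective (count S) S ≤-refl
... | g , g-inj , Sg = outdeg<⇒order≤ (induced g g-inj T) λ i →
  ≤-<-trans (count-∘-injective (adj T (g i)) g-inj) (out<b (g i) (Sg i))

degree-dichotomy⇒order≤ : (T : Tournament p) → (∀ v → indeg T v < a ⊎ outdeg T v < b) →
                          p ≤ (2 * a ∸ 1) + (2 * b ∸ 1)
degree-dichotomy⇒order≤ {p} {a} {b} T in<a⊎out<b = begin
  p                              ≡⟨ sym (count-partition S) ⟩
  count S + count (not ∘ S)      ≤⟨ +-mono-≤ (outdeg<⇒count≤ (reverse T) S S⇒in<a)
                                              (outdeg<⇒count≤ T (not ∘ S) ¬S⇒out<b) ⟩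
  (2 * a ∸ 1) + (2 * b ∸ 1)      ∎
  where
  open ≤-Reasoning
  S : Fin p → Bool
  S v = indeg T v <ᵇ a
  S⇒in<a : ∀ v → S v ≡ true → indeg T v < a
  S⇒in<a v Sv = <ᵇ⇒< _ _ (Equivalence.from T-≡ Sv)
  ¬S⇒out<b : ∀ v → not (S v) ≡ true → outdeg T v < b
  ¬S⇒out<b v ¬Sv = [ (λ in<a → ⊥-elim (not-¬ (Equivalence.to T-≡ (<⇒<ᵇ in<a)) (not-injective ¬Sv)))
                   , id ]′ (in<a⊎out<b v)

∃-vertex-with-degrees : (T : Tournament p) → (2 * a ∸ 1) + (2 * b ∸ 1) < p →
                        ∃ λ v → a ≤ indeg T v × b ≤ outdeg T v
∃-vertex-with-degrees {a = a} {b} T order-large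
  with any? (λ v → (a ≤? indeg T v) ×-dec (b ≤? outdeg T v))
... | yes found = found
... | no none = contradiction (degree-dichotomy⇒order≤ T in<a⊎out<b) (<⇒≱ order-large)
  where
  in<a⊎out<b : ∀ v → indeg T v < a ⊎ outdeg T v < b
  in<a⊎out<b v with a ≤? indeg T v | b ≤? outdeg T v
  ... | no a≰in | _ = inj₁ (≰⇒> a≰in)
  ... | yes _ | no b≰out = inj₂ (≰⇒> b≰out)
  ... | yes a≤in | yes b≤out = contradiction (v , a≤in , b≤out) none

m+n<ᵇm≡false : ∀ m n → (m + n <ᵇ m) ≡ false
m+n<ᵇm≡false zero n = refl
m+n<ᵇm≡false (suc m) n = m+n<ᵇm≡false m n

D₁-arc-↑ˡ : ∀ a b (k : Fin a) → arc (D₁ a b) (suc (k ↑ˡ b)) zero ≡ true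
D₁-arc-↑ˡ a b k = trans (cong (_<ᵇ a) (toℕ-↑ˡ k b)) (Equivalence.to T-≡ (<⇒<ᵇ (toℕ<n k)))

D₁-arc-↑ʳ : ∀ a b (k : Fin b) → arc (D₁ a b) (suc (a ↑ʳ k)) zero ≡ false
D₁-arc-↑ʳ a b k = trans (cong (_<ᵇ a) (toℕ-↑ʳ a k)) (m+n<ᵇm≡false a (toℕ k))

D₁⊑⇒degrees : (T : Tournament p) → D₁ a b ⊑ T → ∃ λ v → a ≤ indeg T v × b ≤ outdeg T v
D₁⊑⇒degrees {a = a} {b} T (f , f-inj , f-arc) =
  f zero ,
  injective⇒≤-count _ (λ k → f (suc (k ↑ˡ b)))
    (λ e → ↑ˡ-injective b _ _ (suc-injective (f-inj e)))
    (λ k → f-arc _ _ (D₁-arc-↑ˡ a b k)) ,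
  injective⇒≤-count _ (λ k → f (suc (a ↑ʳ k)))
    (λ e → ↑ʳ-injective a _ _ (suc-injective (f-inj e)))
    (λ k → f-arc _ _ (cong not (D₁-arc-↑ʳ a b k)))

splitAt-injective : ∀ m {n} → Injective _≡_ _≡_ (splitAt m {n})
splitAt-injective m {n} {i} {j} e =
  trans (sym (join-splitAt m n i)) (trans (cong (join m n) e) (join-splitAt m n j))

star⊑ : (T : Tournament p) (v : Fin p) {ins : Fin a → Fin p} {outs : Fin b → Fin p} →
        Injective _≡_ _≡_ ins → Injective _≡_ _≡_ outs →
        (∀ k → adj T (ins k) v ≡ true) → (∀ k → adj T v (outs k) ≡ true) → D₁ a b ⊑ T
star⊑ {a = a} {b} T v {ins} {outs} ins-inj outs-inj in-arc out-arc =
  f , ∷-injective (splitAt-injective a ∘ nbr-inj) (nbr≢v ∘ splitAt a) , f-arc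
  where
  nbr : Fin a ⊎ Fin b → Fin _
  nbr = [ ins , outs ]′
  f : Fin (suc (a + b)) → Fin _
  f = v ∷ (nbr ∘ splitAt a)
  nbr-inj : Injective _≡_ _≡_ nbr
  nbr-inj {inj₁ k} {inj₁ l} e = cong inj₁ (ins-inj e)
  nbr-inj {inj₂ k} {inj₂ l} e = cong inj₂ (outs-inj e)
  nbr-inj {inj₁ k} {inj₂ l} e =
    ⊥-elim (not-¬ (subst (λ u → adj T u v ≡ true) e (in-arc k)) (antisym T v _ (out-arc l)))
  nbr-inj {inj₂ k} {inj₁ l} e =
    ⊥-elim (not-¬ (subst (λ u → adj T u v ≡ true) (sym e) (in-arc l)) (antisym T v _ (out-arc k)))
  nbr≢v : ∀ s → nbr s ≢ v
  nbr≢v (inj₁ k) e = not-¬ (subst (λ u → adj T u v ≡ true) e (in-arc k)) (loopless T v)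
  nbr≢v (inj₂ k) e = not-¬ (subst (λ u → adj T v u ≡ true) e (out-arc k)) (loopless T v)
  f-arc : ∀ u w → arc (D₁ a b) u w ≡ true → adj T (f u) (f w) ≡ true
  f-arc zero zero ()
  f-arc (suc i) (suc j) ()
  f-arc (suc i) zero e with splitAt a i in split
  ... | inj₁ k = in-arc k
  ... | inj₂ k = ⊥-elim (not-¬ e (subst (λ i → arc (D₁ a b) (suc i) zero ≡ false)
                                          (splitAt⁻¹-↑ʳ split) (D₁-arc-↑ʳ a b k)))
  f-arc zero (suc i) e with splitAt a i in split
  ... | inj₂ k = out-arc k
  ... | inj₁ k = ⊥-elim (not-¬ e (subst (λ i → arc (D₁ a b) zero (suc i) ≡ false)
                                          (splitAt⁻¹-↑ˡ split) (cong not (D₁-arc-↑ˡ a b k))))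

degrees⇒D₁⊑ : (T : Tournament p) → (∃ λ v → a ≤ indeg T v × b ≤ outdeg T v) → D₁ a b ⊑ T
degrees⇒D₁⊑ {a = a} {b} T (v , a≤in , b≤out)
  with ≤-count⇒injective a (λ u → adj T u v) a≤in | ≤-count⇒injective b (adj T v) b≤out
... | ins , ins-inj , in-arc | outs , outs-inj , out-arc = star⊑ T v ins-inj outs-inj in-arc out-arc

⊑-induced : {D : Digraph} {g : Fin m → Fin p} (g-inj : Injective _≡_ _≡_ g) {T : Tournament p} →
            D ⊑ induced g g-inj T → D ⊑ T
⊑-induced {g = g} g-inj (f , f-inj , f-arc) = g ∘ f , f-inj ∘ g-inj , f-arc

Unavoidable-mono : {D : Digraph} → p ≤ q → Unavoidable D p → Unavoidable D q
Unavoidable-mono p≤q D-unavoidable T =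
  ⊑-induced inject-inj {T} (D-unavoidable (induced (λ i → inject≤ i p≤q) inject-inj T))
  where
  inject-inj : Injective _≡_ _≡_ (λ i → inject≤ i p≤q)
  inject-inj {i} {j} = inject≤-injective p≤q p≤q i j

degree-dichotomy⇒D₁⋢ : (T : Tournament p) → (∀ v → indeg T v < a ⊎ outdeg T v < b) → ¬ (D₁ a b ⊑ T)
degree-dichotomy⇒D₁⋢ T in<a⊎out<b D₁⊑T with D₁⊑⇒degrees T D₁⊑T
... | v , a≤in , b≤out = [ (λ in<a → <⇒≱ in<a a≤in) , (λ out<b → <⇒≱ out<b b≤out) ]′ (in<a⊎out<b v)

odd : ℕ → ℕ
odd zero = 1
odd (suc k) = suc (suc (odd k))

odd≡2[1+k]∸1 : ∀ k → odd k ≡ 2 * suc k ∸ 1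
odd≡2[1+k]∸1 zero = refl
odd≡2[1+k]∸1 (suc k) = cong suc (trans (cong suc (odd≡2[1+k]∸1 k)) (sym (+-suc k _)))

evens : ∀ k → Fin (odd k) → Bool
evens zero _ = false
evens (suc k) zero = true
evens (suc k) (suc zero) = false
evens (suc k) (suc (suc i)) = evens k i

count-evens : ∀ k → count (evens k) ≡ k
count-evens zero = refl
count-evens (suc k) = cong suc (count-evens k)

count-odds : ∀ k → count (not ∘ evens k) ≡ suc k
count-odds zero = refl
count-odds (suc k) = cong suc (count-odds k)

-- Two new vertices x = 0 → y = 1 are added to the regular tournament on 2k+1 vertices: x beats
-- the k evens, y the k+1 odds, and every old vertex beats exactly one of x and y.
regular-adj : ∀ k → Fin (odd k) → Fin (odd k) → Bool
regular-adj zero _ _ = false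
regular-adj (suc k) zero zero = false
regular-adj (suc k) zero (suc zero) = true
regular-adj (suc k) zero (suc (suc j)) = evens k j
regular-adj (suc k) (suc zero) zero = false
regular-adj (suc k) (suc zero) (suc zero) = false
regular-adj (suc k) (suc zero) (suc (suc j)) = not (evens k j)
regular-adj (suc k) (suc (suc i)) zero = not (evens k i)
regular-adj (suc k) (suc (suc i)) (suc zero) = evens k i
regular-adj (suc k) (suc (suc i)) (suc (suc j)) = regular-adj k i j

regular-adj-loopless : ∀ k i → regular-adj k i i ≡ false
regular-adj-loopless zero i = refl
regular-adj-loopless (suc k) zero = refl
regular-adj-loopless (suc k) (suc zero) = refl
regular-adj-loopless (suc k) (suc (suc i)) = regular-adj-loopless k i

regular-adj-flip : ∀ k {i j} → i ≢ j → regular-adj k i j ≡ not (regular-adj k j i)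
regular-adj-flip zero {zero} {zero} i≢j = ⊥-elim (i≢j refl)
regular-adj-flip (suc k) {zero} {zero} i≢j = ⊥-elim (i≢j refl)
regular-adj-flip (suc k) {zero} {suc zero} _ = refl
regular-adj-flip (suc k) {zero} {suc (suc j)} _ = sym (not-involutive _)
regular-adj-flip (suc k) {suc zero} {zero} _ = refl
regular-adj-flip (suc k) {suc zero} {suc zero} i≢j = ⊥-elim (i≢j refl)
regular-adj-flip (suc k) {suc zero} {suc (suc j)} _ = refl
regular-adj-flip (suc k) {suc (suc i)} {zero} _ = refl
regular-adj-flip (suc k) {suc (suc i)} {suc zero} _ = sym (not-involutive _)
regular-adj-flip (suc k) {suc (suc i)} {suc (suc j)} i≢j =
  regular-adj-flip k λ { refl → i≢j refl }

regular : ∀ k → Tournament (odd k)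
regular k = tournament (regular-adj k) (regular-adj-loopless k) (regular-adj-flip k)

outdeg-regular : ∀ k v → outdeg (regular k) v ≡ k
outdeg-regular zero zero = refl
outdeg-regular (suc k) zero = cong suc (count-evens k)
outdeg-regular (suc k) (suc zero) = count-odds k
outdeg-regular (suc k) (suc (suc i)) with evens k i
... | true = cong suc (outdeg-regular k i)
... | false = cong suc (outdeg-regular k i)

outdeg<-tournament : ∀ b → Σ (Tournament (2 * b ∸ 1)) λ T → ∀ v → outdeg T v < b
outdeg<-tournament zero = tournament (λ ()) (λ ()) (λ { {()} }) , λ ()
outdeg<-tournament (suc k) =
  subst (λ p → Σ (Tournament p) λ T → ∀ v → outdeg T v < suc k) (odd≡2[1+k]∸1 k)
        (regular k , λ v → ≤-reflexive (cong suc (outdeg-regular k v)))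

▷-adj : Tournament m → Tournament n → Fin m ⊎ Fin n → Fin m ⊎ Fin n → Bool
▷-adj T U (inj₁ i) (inj₁ j) = adj T i j
▷-adj T U (inj₁ _) (inj₂ _) = true
▷-adj T U (inj₂ _) (inj₁ _) = false
▷-adj T U (inj₂ i) (inj₂ j) = adj U i j

▷-adj-loopless : (T : Tournament m) (U : Tournament n) → ∀ s → ▷-adj T U s s ≡ false
▷-adj-loopless T U (inj₁ i) = loopless T i
▷-adj-loopless T U (inj₂ j) = loopless U j

▷-adj-flip : (T : Tournament m) (U : Tournament n) {s t : Fin m ⊎ Fin n} → s ≢ t →
             ▷-adj T U s t ≡ not (▷-adj T U t s)
▷-adj-flip T U {inj₁ i} {inj₁ j} s≢t = adj-flip T (s≢t ∘ cong inj₁)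
▷-adj-flip T U {inj₁ _} {inj₂ _} _ = refl
▷-adj-flip T U {inj₂ _} {inj₁ _} _ = refl
▷-adj-flip T U {inj₂ i} {inj₂ j} s≢t = adj-flip U (s≢t ∘ cong inj₂)

_▷_ : Tournament m → Tournament n → Tournament (m + n)
_▷_ {m} T U = tournament (λ v w → ▷-adj T U (splitAt m v) (splitAt m w))
  (▷-adj-loopless T U ∘ splitAt m) (λ v≢w → ▷-adj-flip T U (v≢w ∘ splitAt-injective m))

adj-▷-join : (T : Tournament m) (U : Tournament n) (s t : Fin m ⊎ Fin n) →
             adj (T ▷ U) (join m n s) (join m n t) ≡ ▷-adj T U s t
adj-▷-join {m} {n} T U s t = cong₂ (▷-adj T U) (splitAt-join m n s) (splitAt-join m n t)

indeg-▷-↑ˡ : (T : Tournament m) (U : Tournament n) (i : Fin m) → indeg (T ▷ U) (i ↑ˡ n) ≡ indeg T i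
indeg-▷-↑ˡ {m} {n} T U i = begin
  indeg (T ▷ U) (i ↑ˡ n)
    ≡⟨ sum-↑ m _ ⟩
  count (λ j → adj (T ▷ U) (j ↑ˡ n) (i ↑ˡ n)) + count (λ j → adj (T ▷ U) (m ↑ʳ j) (i ↑ˡ n))
    ≡⟨ cong₂ _+_ (count-cong λ j → adj-▷-join T U (inj₁ j) (inj₁ i))
                 (count-cong λ j → adj-▷-join T U (inj₂ j) (inj₁ i)) ⟩
  indeg T i + count {n} (λ _ → false)
    ≡⟨ cong (indeg T i +_) (sum-replicate-zero n) ⟩
  indeg T i + 0
    ≡⟨ +-identityʳ _ ⟩
  indeg T i ∎
  where open ≡-Reasoning

outdeg-▷-↑ʳ : (T : Tournament m) (U : Tournament n) (j : Fin n) → outdeg (T ▷ U) (m ↑ʳ j) ≡ outdeg U j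
outdeg-▷-↑ʳ {m} {n} T U j = begin
  outdeg (T ▷ U) (m ↑ʳ j)
    ≡⟨ sum-↑ m _ ⟩
  count (λ i → adj (T ▷ U) (m ↑ʳ j) (i ↑ˡ n)) + count (λ i → adj (T ▷ U) (m ↑ʳ j) (m ↑ʳ i))
    ≡⟨ cong₂ _+_ (count-cong λ i → adj-▷-join T U (inj₂ j) (inj₁ i))
                 (count-cong λ i → adj-▷-join T U (inj₂ j) (inj₂ i)) ⟩
  count {m} (λ _ → false) + outdeg U j
    ≡⟨ cong (_+ outdeg U j) (sum-replicate-zero m) ⟩
  outdeg U j ∎
  where open ≡-Reasoning

degree-dichotomy-▷ : (T : Tournament m) (U : Tournament n) →
                     (∀ i → indeg T i < a) → (∀ j → outdeg U j < b) →
                     ∀ v → indeg (T ▷ U) v < a ⊎ outdeg (T ▷ U) v < b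
degree-dichotomy-▷ {m} {n} {a} {b} T U in<a out<b v =
  subst (λ w → indeg (T ▷ U) w < a ⊎ outdeg (T ▷ U) w < b) (join-splitAt m n v) (by-side (splitAt m v))
  where
  by-side : ∀ s → indeg (T ▷ U) (join m n s) < a ⊎ outdeg (T ▷ U) (join m n s) < b
  by-side (inj₁ i) = inj₁ (subst (_< a) (sym (indeg-▷-↑ˡ T U i)) (in<a i))
  by-side (inj₂ j) = inj₂ (subst (_< b) (sym (outdeg-▷-↑ʳ T U j)) (out<b j))

unv-D₁ : ∀ a b → UnvIs (D₁ a b) (suc ((2 * a ∸ 1) + (2 * b ∸ 1)))
unv-D₁ a b = (λ T → degrees⇒D₁⊑ T (∃-vertex-with-degrees T ≤-refl)) , avoidable
  where
  avoidable : ∀ p → p < suc ((2 * a ∸ 1) + (2 * b ∸ 1)) → ¬ Unavoidable (D₁ a b) p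
  avoidable p (s≤s p≤order) D₁-unavoidable with outdeg<-tournament a | outdeg<-tournament b
  ... | A , out<a | B , out<b =
    degree-dichotomy⇒D₁⋢ (reverse A ▷ B) (degree-dichotomy-▷ (reverse A) B out<a out<b)
      (Unavoidable-mono p≤order D₁-unavoidable (reverse A ▷ B))

1+[2[n∸1]∸1]≡2n∸2 : ∀ n → 2 ≤ n → suc (2 * (n ∸ 1) ∸ 1) ≡ 2 * n ∸ 2
1+[2[n∸1]∸1]≡2n∸2 (suc (suc k)) (s≤s (s≤s z≤n)) = *-distribˡ-∸ 2 (suc (suc k)) 1

1+[2n₁∸1]+[2n₂∸1]≡2[n₁+n₂+1]∸3 : ∀ {n₁ n₂} → 1 ≤ n₁ → 1 ≤ n₂ →
                                 suc ((2 * n₁ ∸ 1) + (2 * n₂ ∸ 1)) ≡ 2 * (n₁ + n₂ + 1) ∸ 3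
1+[2n₁∸1]+[2n₂∸1]≡2[n₁+n₂+1]∸3 {suc x} {suc y} _ _ = begin
  suc ((2 * suc x ∸ 1) + (2 * suc y ∸ 1))  ≡⟨⟩
  2 * suc x + (2 * suc y ∸ 1)              ≡⟨ sym (+-∸-assoc (2 * suc x) (s≤s z≤n)) ⟩
  (2 * suc x + 2 * suc y) ∸ 1              ≡⟨⟩
  (2 + (2 * suc x + 2 * suc y)) ∸ 3        ≡⟨ cong (_∸ 3) (regroup (suc x) (suc y)) ⟩
  2 * (suc x + suc y + 1) ∸ 3              ∎
  where
  open ≡-Reasoning
  regroup : ∀ x y → 2 + (2 * x + 2 * y) ≡ 2 * (x + y + 1)
  regroup = solve-∀

proposition26 : (n n₁ n₂ : ℕ) → 1 ≤ n₁ → 1 ≤ n₂ → n ≡ n₁ + n₂ + 1 →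
    UnvIs (D₁ 0 (n ∸ 1)) (2 * n ∸ 2) × UnvIs (D₁ (n ∸ 1) 0) (2 * n ∸ 2)
    × UnvIs (D₁ n₁ n₂) (2 * n ∸ 3)
proposition26 n n₁ n₂ 1≤n₁ 1≤n₂ refl =
    subst (UnvIs _) order-star (unv-D₁ 0 (n ∸ 1))
  , subst (UnvIs _) (trans (cong suc (+-identityʳ _)) order-star) (unv-D₁ (n ∸ 1) 0)
  , subst (UnvIs _) (1+[2n₁∸1]+[2n₂∸1]≡2[n₁+n₂+1]∸3 1≤n₁ 1≤n₂) (unv-D₁ n₁ n₂)
  where
  order-star : suc (2 * (n ∸ 1) ∸ 1) ≡ 2 * n ∸ 2
  order-star = 1+[2[n∸1]∸1]≡2n∸2 n (+-monoˡ-≤ 1 (≤-trans 1≤n₁ (m≤m+n n₁ n₂)))
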